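{- Let $\Gamma = (V, E)$ be a connected $k$-regular graph, where $k \ge 1$. Let $\pi = \{V_1, \ldots, V_m\}$ be an equitable partition of $\Gamma$ with quotient matrix $M_{\pi} = (b_{ij})_{1 \le i,j \le m}$ and $W_1$ an $(a, b)$-perfect set in $\Gamma$, where $0 \le a \le k-1$ and $1 \le b \le k$; let $W_2 = V\setminus W_1$. \begin{enumerate} \item[(a)] The vector $[h_1, \ldots, h_m]^\top$ defined by $$h_t = \frac{|V_t \cap W_1|}{|V_t|} - \frac{b}{k-a+b}\quad \text{ for } 1 \le t \le m$$ is a solution to the homogeneous system of linear equations $$(M_{\pi} + (b-a)I_m) \begin{bmatrix} y_1 \\ \vdots \\ y_m\end{bmatrix} = \begin{bmatrix} 0 \\ \vdots \\ 0\end{bmatrix}.$$ In particular, either $\frac{|V_t \cap W_1|}{|V_t|} = \frac{b}{k-a+b}$ for each $1 \le t \le m$, or $a-b$ is an eigenvalue of $M_{\pi}$ (and hence an eigenvalue of $\Gamma$) with $[h_1, \ldots, h_m]^\top$ as a corresponding eigenvector. \item[(b)] For any $1 \le i, j \le m$ with $i \ne j$, the following hold: \begin{enumerate} \item[(i)] the system of linear equations $$(M_{\pi} + (b_{ij} - b_{jj}) I_m) \begin{bmatrix} x_1\\ \vdots \\ x_m\end{bmatrix} = \begin{bmatrix} (b_{1j} - b_{ij}) + \delta_{1j}(b_{ij} - b_{jj}) \\ \vdots \\ (b_{mj} - b_{ij}) + \delta_{mj}(b_{ij} - b_{jj})\end{bmatrix} \qquad (\ast)$$ is consistent; \item[(ii)]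 for any solution $(d_1, \ldots, d_m)$ to $(\ast)$, the vector $[h_1, h_2]^\top$ defined by $$h_1 = - \frac{b_{ij}}{k+b_{ij}-b_{jj}} - \sum_{l = 1}^m \frac{|W_1 \cap V_l|}{|W_1|}(d_l - \delta_{lj}),\quad h_2 = - \frac{b_{ij}}{k+b_{ij}-b_{jj}} - \sum_{l = 1}^m \frac{|W_2 \cap V_l|}{|W_2|}(d_l - \delta_{lj})$$ is a solution to the system of equations $$\begin{bmatrix} a + b_{ij} - b_{jj} & k-a \\ b & k - b + b_{ij} - b_{jj}\end{bmatrix} \begin{bmatrix} y_1\\ y_2\end{bmatrix} = \begin{bmatrix} 0 \\ 0\end{bmatrix};$$ \item[(iii)] in particular, if $b_{jj} - b_{ij}$ is neither $k$ nor $a-b$, then for any solution $(d_1,\ldots,d_m)$ to $(\ast)$, $$\sum_{l = 1}^m \frac{|W_1 \cap V_l|}{|W_1|}(d_l - \delta_{lj}) = \sum_{l = 1}^m \frac{|W_2 \cap V_l|}{|W_2|}(d_l - \delta_{lj}) = - \frac{b_{ij}}{k+b_{ij}-b_{jj}}.$$ \end{enumerate} \end{enumerate}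
   Context: A partition $\{V_1,\ldots,V_m\}$ of the vertex set of a graph is an equitable partition with quotient matrix $(b_{ij})$ if every vertex in $V_i$ has exactly $b_{ij}$ neighbours in $V_j$. For a connected $k$-regular graph, a nonempty proper subset $W_1$ of $V$ is an $(a,b)$-perfect set if $\{W_1, V\setminus W_1\}$ is an equitable partition with quotient matrix $\begin{bmatrix} a & k-a\\ b & k-b\end{bmatrix}$. $\delta$ denotes the Kronecker delta and $I_m$ the $m\times m$ identity matrix. -}

module Defs where

open import Data.Nat as ℕ using (ℕ; zero; suc)
open import Data.Integer as ℤ using (ℤ; +_)
open import Data.Rational as ℚ using (ℚ; 0ℚ; 1ℚ; _÷_; ≢-nonZero)
open import Data.Rational.Properties using (_≟_)
open import Data.Fin as Fin using (Fin)
import Data.Fin.Properties as FinP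
open import Data.Bool using (Bool; true; false; _∧_; not; if_then_else_)
open import Data.Product using (Σ; ∃; _×_; _,_)
open import Relation.Binary.PropositionalEquality using (_≡_; _≢_)
open import Relation.Nullary using (yes; no; ¬_)
open import Relation.Nullary.Decidable using (⌊_⌋)

record Graph (n : ℕ) : Set where
  field
    adj     : Fin n → Fin n → Bool
    adj-sym : ∀ u v → adj u v ≡ adj v u
    adj-irr : ∀ v → adj v v ≡ false
open Graph public

count : ∀ {n} → (Fin n → Bool) → ℕ
count {zero}  f = 0
count {suc n} f = (if f Fin.zero then 1 else 0) ℕ.+ count (λ i → f (Fin.suc i))

nbrsIn : ∀ {n} → Graph n → Fin n → (Fin n → Bool) → ℕ
nbrsIn G v S = count (λ u → adj G v u ∧ S u)

data Walk {n} (G : Graph n) : Fin n → Fin n → Set where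
  here : ∀ {v} → Walk G v v
  step : ∀ {u v w} → adj G u v ≡ true → Walk G v w → Walk G u w

Connected : ∀ {n} → Graph n → Set
Connected {n} G = Σ (Fin n) (λ _ → ∀ u v → Walk G u v)   -- nonempty and connected

Regular : ∀ {n} → Graph n → ℕ → Set
Regular G k = ∀ v → nbrsIn G v (λ _ → true) ≡ k

cell : ∀ {n m} → (Fin n → Fin m) → Fin m → Fin n → Bool
cell part i v = ⌊ part v Fin.≟ i ⌋

-- {V_1,...,V_m} (nonempty cells V_i = part⁻¹(i)) is an equitable partition
-- with quotient matrix B
IsEquitablePartition : ∀ {n m} → Graph n → (Fin n → Fin m) → (Fin m → Fin m → ℕ) → Set
IsEquitablePartition {n} {m} G part B =
  (∀ i → Σ (Fin n) (λ v → part v ≡ i)) ×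
  (∀ v j → nbrsIn G v (cell part j) ≡ B (part v) j)

IsPerfectSet : ∀ {n} → Graph n → ℕ → (Fin n → Bool) → ℕ → ℕ → Set
IsPerfectSet {n} G k W a b =
  Σ (Fin n) (λ v → W v ≡ true) × Σ (Fin n) (λ v → W v ≡ false) ×
  (∀ v → W v ≡ true  → nbrsIn G v W ≡ a × nbrsIn G v (λ u → not (W u)) ≡ k ℕ.∸ a) ×
  (∀ v → W v ≡ false → nbrsIn G v W ≡ b × nbrsIn G v (λ u → not (W u)) ≡ k ℕ.∸ b)

ℕ→ℚ : ℕ → ℚ
ℕ→ℚ n = (+ n) ℚ./ 1

-- total division (x / 0 := 0); only ever applied to nonzero denominators
-- under the theorem's hypotheses
_//_ : ℚ → ℚ → ℚ
p // q with q ≟ 0ℚ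
... | yes _  = 0ℚ
... | no q≢0 = _÷_ p q {{≢-nonZero q≢0}}

sumℚ : ∀ {m} → (Fin m → ℚ) → ℚ
sumℚ {zero}  f = 0ℚ
sumℚ {suc m} f = f Fin.zero ℚ.+ sumℚ (λ i → f (Fin.suc i))

δ : ∀ {m} → Fin m → Fin m → ℚ
δ i j with i Fin.≟ j
... | yes _ = 1ℚ
... | no _  = 0ℚ

mulVec : ∀ {m} → (Fin m → Fin m → ℚ) → (Fin m → ℚ) → Fin m → ℚ
mulVec M y i = sumℚ (λ j → M i j ℚ.* y j)

IsEigenvector : ∀ {m} → (Fin m → Fin m → ℚ) → ℚ → (Fin m → ℚ) → Set
IsEigenvector {m} M λ' y = Σ (Fin m) (λ t → y t ≢ 0ℚ) × (∀ i → mulVec M y i ≡ λ' ℚ.* y i)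

IsEigenvalue : ∀ {m} → (Fin m → Fin m → ℚ) → ℚ → Set
IsEigenvalue {m} M λ' = Σ (Fin m → ℚ) (IsEigenvector M λ')

adjMatrix : ∀ {n} → Graph n → Fin n → Fin n → ℚ
adjMatrix G u v = if adj G u v then 1ℚ else 0ℚ

toℚMat : ∀ {m} → (Fin m → Fin m → ℕ) → Fin m → Fin m → ℚ
toℚMat B i j = ℕ→ℚ (B i j)

{-# OPTIONS --safe #-}
-- Let ω be the indicator of W and Adj the adjacency matrix. Being (a,b)-perfect means
-- Adj ω = a ω + b (1 - ω), so ω - β with β = b/(k-a+b) is an eigenvector of Adj for a - b.
-- Averaging a vertex vector over the cells of an equitable partition turns an eigenvector
-- of Adj into one of the quotient matrix M (via |V_s| b_st = |V_t| b_ts, which is the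
-- symmetry of Adj), and the cell averages of ω - β are the h_t of (a).
-- For (b), if d solves (∗) then u = e - (d - δ_j) with e = -b_ij/(k + b_ij - b_jj) satisfies
-- M u = -(b_ij - b_jj) u, so its lift U = u ∘ part is an eigenvector of Adj. Pairing Adj U
-- with the indicators of W₁ and W₂ and moving Adj across gives two linear relations between
-- ω · U = |W₁| (e - s₁) and (1 - ω) · U = |W₂| (e - s₂); together with |W₁| (k - a) = |W₂| b
-- they are the 2×2 system of (ii), whose determinant (k + b_ij - b_jj)(a - b + b_ij - b_jj)
-- yields (iii).
module Submission where

open import Defs
open import Data.Nat as ℕ using (ℕ; _≤_; _<_)
open import Data.Rational as ℚ using (ℚ; 0ℚ; _+_; _-_; _*_; -_)
open import Data.Fin using (Fin)
open import Data.Bool using (Bool; _∧_; not)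
open import Data.Product using (Σ; _×_)
open import Data.Sum using (_⊎_)
open import Relation.Binary.PropositionalEquality using (_≡_; _≢_)

open import Algebra.Bundles using (CommutativeRing)
open import Data.Bool using (true; false; if_then_else_)
open import Data.Fin using (zero; suc)
import Data.Fin as Fin
import Data.Fin.Properties as FinP
import Data.Integer as ℤ
open import Data.Integer.GCD using (gcd)
import Data.Integer.Properties as ℤP
open import Data.Integer.Tactic.RingSolver using (solve-∀)
open import Data.Nat using (zero; suc; z≤n)
import Data.Nat.Properties as ℕP
open import Data.Product using (_,_; proj₁; proj₂; uncurry)
open import Data.Rational using (1ℚ; 1/_; toℚᵘ; ≢-nonZero)
import Data.Rational.Properties as ℚP
open import Data.Rational.Solver using (module +-*-Solver)
import Data.Rational.Unnormalised as ℚᵘ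
import Data.Rational.Unnormalised.Properties as ℚᵘP
open import Data.Sum using (inj₁; inj₂)
open import Data.Vec.Functional using (removeAt)
open import Function using (_∘_)
open import Relation.Binary.PropositionalEquality using (refl; sym; trans; cong; cong₂; subst; module ≡-Reasoning)
open import Algebra.Properties.Group ℚP.+-0-group using (x∙y⁻¹≈ε⇒x≈y)
open import Data.Empty using (⊥-elim)
open import Relation.Nullary using (Dec; yes; no)
open import Algebra.Properties.Semiring.Sum (CommutativeRing.semiring ℚP.+-*-commutativeRing)
  as Sum using (sum)

open +-*-Solver using (solve; _:=_; _:+_; _:-_; _:*_; :-_; con)
open ≡-Reasoning

ℕ→ℚ-+ : ∀ m n → ℕ→ℚ (m ℕ.+ n) ≡ ℕ→ℚ m + ℕ→ℚ n
ℕ→ℚ-+ m n = ℚP.toℚᵘ-injective (begin-≃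
    toℚᵘ (ℕ→ℚ (m ℕ.+ n))                   ≈⟨ ℚP.toℚᵘ-fromℚᵘ (ℚᵘ.mkℚᵘ (ℤ.+ (m ℕ.+ n)) 0) ⟩
    ℚᵘ.mkℚᵘ (ℤ.+ m ℤ.+ ℤ.+ n) 0             ≈⟨ ℚᵘ.*≡* (integer-sum (ℤ.+ m) (ℤ.+ n)) ⟩
    ℚᵘ.mkℚᵘ (ℤ.+ m) 0 ℚᵘ.+ ℚᵘ.mkℚᵘ (ℤ.+ n) 0 ≈⟨ ℚᵘP.+-cong (ℚP.toℚᵘ-fromℚᵘ (ℚᵘ.mkℚᵘ (ℤ.+ m) 0))
                                                         (ℚP.toℚᵘ-fromℚᵘ (ℚᵘ.mkℚᵘ (ℤ.+ n) 0)) ⟨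
    toℚᵘ (ℕ→ℚ m) ℚᵘ.+ toℚᵘ (ℕ→ℚ n)          ≈⟨ ℚP.toℚᵘ-homo-+ (ℕ→ℚ m) (ℕ→ℚ n) ⟨
    toℚᵘ (ℕ→ℚ m + ℕ→ℚ n)                   ∎≃)
  where
  open ℚᵘP.≃-Reasoning renaming (begin_ to begin-≃_; _∎ to _∎≃)
  integer-sum : ∀ x y → (x ℤ.+ y) ℤ.* (ℤ.+ 1 ℤ.* ℤ.+ 1) ≡ (x ℤ.* ℤ.+ 1 ℤ.+ y ℤ.* ℤ.+ 1) ℤ.* ℤ.+ 1
  integer-sum = solve-∀

ℕ→ℚ-∸ : ∀ {m n} → n ≤ m → ℕ→ℚ (m ℕ.∸ n) ≡ ℕ→ℚ m - ℕ→ℚ n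
ℕ→ℚ-∸ {m} {n} n≤m = begin
  ℕ→ℚ (m ℕ.∸ n)                      ≡⟨ solve 2 (λ x y → x := (x :+ y) :- y) refl (ℕ→ℚ (m ℕ.∸ n)) (ℕ→ℚ n) ⟩
  ℕ→ℚ (m ℕ.∸ n) + ℕ→ℚ n - ℕ→ℚ n      ≡⟨ cong (_- ℕ→ℚ n) (ℕ→ℚ-+ (m ℕ.∸ n) n) ⟨
  ℕ→ℚ (m ℕ.∸ n ℕ.+ n) - ℕ→ℚ n        ≡⟨ cong (λ x → ℕ→ℚ x - ℕ→ℚ n) (ℕP.m∸n+n≡m n≤m) ⟩
  ℕ→ℚ m - ℕ→ℚ n                      ∎

ℕ→ℚ≡0⇒≡0 : ∀ {n} → ℕ→ℚ n ≡ 0ℚ → n ≡ 0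
ℕ→ℚ≡0⇒≡0 {n} n≡0 = ℤP.+-injective (begin
  ℤ.+ n                 ≡⟨ ℚP.↥-/ (ℤ.+ n) 1 ⟨
  ℚ.↥ (ℕ→ℚ n) ℤ.* g     ≡⟨ cong (λ q → ℚ.↥ q ℤ.* g) n≡0 ⟩
  ℤ.+ 0 ℤ.* g           ≡⟨ ℤP.*-zeroˡ g ⟩
  ℤ.+ 0                 ∎)
  where g = gcd (ℤ.+ n) (ℤ.+ 1)

//-cancelʳ : ∀ p {q} → q ≢ 0ℚ → (p // q) * q ≡ p
//-cancelʳ p {q} q≢0 with q ℚP.≟ 0ℚ
... | yes q≡0 = ⊥-elim (q≢0 q≡0)
... | no q≢0′ = begin
  p * 1/ q * q      ≡⟨ ℚP.*-assoc p (1/ q) q ⟩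
  p * (1/ q * q)    ≡⟨ cong (p *_) (ℚP.*-inverseˡ q) ⟩
  p * 1ℚ            ≡⟨ ℚP.*-identityʳ p ⟩
  p                 ∎
  where instance _ = ≢-nonZero q≢0′

*-cancelˡ-≢0 : ∀ {p} q r → p ≢ 0ℚ → p * q ≡ p * r → q ≡ r
*-cancelˡ-≢0 {p} q r p≢0 pq≡pr = trans (sym (undo q)) (trans (cong (1/ p *_) pq≡pr) (undo r))
  where
  instance _ = ≢-nonZero p≢0
  undo : ∀ x → 1/ p * (p * x) ≡ x
  undo x = begin
    1/ p * (p * x)   ≡⟨ ℚP.*-assoc (1/ p) p x ⟨
    1/ p * p * x     ≡⟨ cong (_* x) (ℚP.*-inverseˡ p) ⟩
    1ℚ * x           ≡⟨ ℚP.*-identityˡ x ⟩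
    x                ∎

sumℚ≡sum : ∀ {m} (f : Fin m → ℚ) → sumℚ f ≡ sum f
sumℚ≡sum {zero}  f = refl
sumℚ≡sum {suc m} f = cong (f zero +_) (sumℚ≡sum (f ∘ suc))

sumℚ-cong : ∀ {m} {f g : Fin m → ℚ} → (∀ i → f i ≡ g i) → sumℚ f ≡ sumℚ g
sumℚ-cong {f = f} {g} f≗g = trans (sumℚ≡sum f) (trans (Sum.sum-cong-≗ f≗g) (sym (sumℚ≡sum g)))

sumℚ-distrib-+ : ∀ {m} (f g : Fin m → ℚ) → sumℚ (λ i → f i + g i) ≡ sumℚ f + sumℚ g
sumℚ-distrib-+ f g rewrite sumℚ≡sum (λ i → f i + g i) | sumℚ≡sum f | sumℚ≡sum g = Sum.∑-distrib-+ f g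

sumℚ-*ˡ : ∀ {m} c (f : Fin m → ℚ) → sumℚ (λ i → c * f i) ≡ c * sumℚ f
sumℚ-*ˡ c f rewrite sumℚ≡sum (λ i → c * f i) | sumℚ≡sum f = sym (Sum.*-distribˡ-sum c f)

sumℚ-*ʳ : ∀ {m} c (f : Fin m → ℚ) → sumℚ (λ i → f i * c) ≡ sumℚ f * c
sumℚ-*ʳ c f rewrite sumℚ≡sum (λ i → f i * c) | sumℚ≡sum f = sym (Sum.*-distribʳ-sum c f)

sumℚ-comm : ∀ {m p} (f : Fin m → Fin p → ℚ) →
            sumℚ (λ i → sumℚ (f i)) ≡ sumℚ (λ j → sumℚ (λ i → f i j))
sumℚ-comm f = begin
  sumℚ (λ i → sumℚ (f i))             ≡⟨ sumℚ-cong (λ i → sumℚ≡sum (f i)) ⟩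
  sumℚ (λ i → sum (f i))              ≡⟨ sumℚ≡sum (λ i → sum (f i)) ⟩
  sum (λ i → sum (f i))               ≡⟨ Sum.∑-comm f ⟩
  sum (λ j → sum (λ i → f i j))       ≡⟨ sumℚ≡sum (λ j → sum (λ i → f i j)) ⟨
  sumℚ (λ j → sum (λ i → f i j))      ≡⟨ sumℚ-cong (λ j → sumℚ≡sum (λ i → f i j)) ⟨
  sumℚ (λ j → sumℚ (λ i → f i j))     ∎

sumℚ-select : ∀ {m} (f : Fin m → ℚ) i → (∀ j → j ≢ i → f j ≡ 0ℚ) → sumℚ f ≡ f i
sumℚ-select {suc m} f i vanishes = begin
  sumℚ f                     ≡⟨ sumℚ≡sum f ⟩
  sum f                      ≡⟨ Sum.sum-remove f ⟩
  f i + sum (removeAt f i)   ≡⟨ cong (f i +_) (Sum.sum-cong-≗ off-i) ⟩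
  f i + sum {m} (λ _ → 0ℚ)   ≡⟨ cong (f i +_) (Sum.sum-replicate-zero m) ⟩
  f i + 0ℚ                   ≡⟨ ℚP.+-identityʳ (f i) ⟩
  f i                        ∎
  where
  off-i : ∀ j → removeAt f i j ≡ 0ℚ
  off-i j = vanishes (Fin.punchIn i j) (FinP.punchInᵢ≢i i j)

δ-refl : ∀ {m} (i : Fin m) → δ i i ≡ 1ℚ
δ-refl i with i Fin.≟ i
... | yes _   = refl
... | no i≢i = ⊥-elim (i≢i refl)

δ-≢ : ∀ {m} {i j : Fin m} → i ≢ j → δ i j ≡ 0ℚ
δ-≢ {i = i} {j} i≢j with i Fin.≟ j
... | yes i≡j = ⊥-elim (i≢j i≡j)
... | no _    = refl

sumℚ-δˡ : ∀ {m} i (f : Fin m → ℚ) → sumℚ (λ j → δ i j * f j) ≡ f i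
sumℚ-δˡ i f = trans (sumℚ-select _ i off-i)
                    (trans (cong (_* f i) (δ-refl i)) (ℚP.*-identityˡ (f i)))
  where
  off-i : ∀ j → j ≢ i → δ i j * f j ≡ 0ℚ
  off-i j j≢i = trans (cong (_* f j) (δ-≢ (j≢i ∘ sym))) (ℚP.*-zeroˡ (f j))

mulVec-δ : ∀ {m} (M : Fin m → Fin m → ℚ) j t → mulVec M (λ s → δ s j) t ≡ M t j
mulVec-δ M j t = trans (sumℚ-select _ j off-j)
                       (trans (cong (M t j *_) (δ-refl j)) (ℚP.*-identityʳ (M t j)))
  where
  off-j : ∀ s → s ≢ j → M t s * δ s j ≡ 0ℚ
  off-j s s≢j = trans (cong (M t s *_) (δ-≢ s≢j)) (ℚP.*-zeroʳ (M t s))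

indicator : ∀ {n} → (Fin n → Bool) → Fin n → ℚ
indicator S v = if S v then 1ℚ else 0ℚ

indicator-∧ : ∀ {n} (S T : Fin n → Bool) v → indicator (λ u → S u ∧ T u) v ≡ indicator S v * indicator T v
indicator-∧ S T v with S v
... | true  = sym (ℚP.*-identityˡ (indicator T v))
... | false = sym (ℚP.*-zeroˡ (indicator T v))

indicator-not : ∀ {n} (S : Fin n → Bool) v → indicator (λ u → not (S u)) v ≡ 1ℚ - indicator S v
indicator-not S v with S v
... | true  = refl
... | false = refl

count-as-sum : ∀ {n} (S : Fin n → Bool) → ℕ→ℚ (count S) ≡ sumℚ (indicator S)
count-as-sum {zero}  S = refl
count-as-sum {suc n} S = trans (ℕ→ℚ-+ (if S zero then 1 else 0) (count (S ∘ suc)))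
                               (cong₂ _+_ (bit (S zero)) (count-as-sum (S ∘ suc)))
  where
  bit : ∀ b → ℕ→ℚ (if b then 1 else 0) ≡ (if b then 1ℚ else 0ℚ)
  bit true  = refl
  bit false = refl

count-∧ : ∀ {n} (S T : Fin n → Bool) →
          ℕ→ℚ (count (λ v → S v ∧ T v)) ≡ sumℚ (λ v → indicator S v * indicator T v)
count-∧ S T = trans (count-as-sum (λ v → S v ∧ T v)) (sumℚ-cong (indicator-∧ S T))

count-≢0 : ∀ {n} (S : Fin n → Bool) v → S v ≡ true → ℕ→ℚ (count S) ≢ 0ℚ
count-≢0 S v Sv = positive S v Sv ∘ ℕ→ℚ≡0⇒≡0
  where
  positive : ∀ {n} (S : Fin n → Bool) v → S v ≡ true → count S ≢ 0
  positive S zero    Sv rewrite Sv = λ ()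
  positive S (suc v) Sv with S zero
  ... | true  = λ ()
  ... | false = positive (S ∘ suc) v Sv

count-mono : ∀ {n} {S T : Fin n → Bool} → (∀ v → S v ≡ true → T v ≡ true) → count S ≤ count T
count-mono {zero}          S⊆T = z≤n
count-mono {suc n} {S} {T} S⊆T = ℕP.+-mono-≤ (bit (S zero) (T zero) (S⊆T zero)) (count-mono (S⊆T ∘ suc))
  where
  bit : ∀ s t → (s ≡ true → t ≡ true) → (if s then 1 else 0) ≤ (if t then 1 else 0)
  bit false t     _   = z≤n
  bit true  true  _   = ℕP.≤-refl
  bit true  false s⇒t with () ← s⇒t refl

infix 8 _·_

_·_ : ∀ {n} → (Fin n → ℚ) → (Fin n → ℚ) → ℚ
x · y = sumℚ (λ v → x v * y v)

·-comm : ∀ {n} (x y : Fin n → ℚ) → x · y ≡ y · x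
·-comm x y = sumℚ-cong (λ v → ℚP.*-comm (x v) (y v))

·-congʳ : ∀ {n} (x : Fin n → ℚ) {y z : Fin n → ℚ} → (∀ v → y v ≡ z v) → x · y ≡ x · z
·-congʳ x y≗z = sumℚ-cong (λ v → cong (x v *_) (y≗z v))

·-distribʳ-+ : ∀ {n} (x y z : Fin n → ℚ) → x · (λ v → y v + z v) ≡ x · y + x · z
·-distribʳ-+ x y z = trans (sumℚ-cong (λ v → ℚP.*-distribˡ-+ (x v) (y v) (z v)))
                           (sumℚ-distrib-+ (λ v → x v * y v) (λ v → x v * z v))

·-scalarʳ : ∀ {n} (x : Fin n → ℚ) α (y : Fin n → ℚ) → x · (λ v → α * y v) ≡ α * (x · y)
·-scalarʳ x α y = trans (sumℚ-cong (λ v → solve 3 (λ x a y → x :* (a :* y) := a :* (x :* y)) refl (x v) α (y v)))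
                        (sumℚ-*ˡ α (λ v → x v * y v))

·-negʳ : ∀ {n} (x y : Fin n → ℚ) → x · (λ v → - y v) ≡ - (x · y)
·-negʳ x y = begin
  x · (λ v → - y v)          ≡⟨ ·-congʳ x (λ v → solve 1 (λ y → :- y := (:- con 1ℚ) :* y) refl (y v)) ⟩
  x · (λ v → - 1ℚ * y v)     ≡⟨ ·-scalarʳ x (- 1ℚ) y ⟩
  - 1ℚ * (x · y)             ≡⟨ solve 1 (λ s → (:- con 1ℚ) :* s := :- s) refl (x · y) ⟩
  - (x · y)                  ∎

·-distribʳ-- : ∀ {n} (x y z : Fin n → ℚ) → x · (λ v → y v - z v) ≡ x · y - x · z
·-distribʳ-- x y z = trans (·-distribʳ-+ x y (λ v → - z v)) (cong (x · y +_) (·-negʳ x z))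

·-mulVec-sym : ∀ {n} (M : Fin n → Fin n → ℚ) → (∀ u v → M u v ≡ M v u) →
               ∀ x y → x · mulVec M y ≡ mulVec M x · y
·-mulVec-sym M M-sym x y = begin
  x · mulVec M y                                  ≡⟨ sumℚ-cong (λ v → sumℚ-*ˡ (x v) (λ w → M v w * y w)) ⟨
  sumℚ (λ v → sumℚ (λ w → x v * (M v w * y w)))   ≡⟨ sumℚ-comm (λ v w → x v * (M v w * y w)) ⟩
  sumℚ (λ w → sumℚ (λ v → x v * (M v w * y w)))   ≡⟨ sumℚ-cong (λ w → sumℚ-cong (λ v → regroup v w)) ⟩
  sumℚ (λ w → sumℚ (λ v → M w v * x v * y w))     ≡⟨ sumℚ-cong (λ w → sumℚ-*ʳ (y w) (λ v → M w v * x v)) ⟩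
  mulVec M x · y                                  ∎
  where
  regroup : ∀ v w → x v * (M v w * y w) ≡ M w v * x v * y w
  regroup v w rewrite M-sym v w = solve 3 (λ x m y → x :* (m :* y) := m :* x :* y) refl (x v) (M w v) (y w)

·-const : ∀ {n} (x : Fin n → ℚ) α → x · (λ _ → α) ≡ α * (x · (λ _ → 1ℚ))
·-const x α = trans (·-congʳ x (λ _ → sym (ℚP.*-identityʳ α))) (·-scalarʳ x α (λ _ → 1ℚ))

·-one : ∀ {n} (x : Fin n → ℚ) → x · (λ _ → 1ℚ) ≡ sumℚ x
·-one x = sumℚ-cong (λ v → ℚP.*-identityʳ (x v))

adjMatrix-sym : ∀ {n} (G : Graph n) u v → adjMatrix G u v ≡ adjMatrix G v u
adjMatrix-sym G u v = cong (λ b → if b then 1ℚ else 0ℚ) (adj-sym G u v)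

nbrsIn-as-mulVec : ∀ {n} (G : Graph n) v S → ℕ→ℚ (nbrsIn G v S) ≡ mulVec (adjMatrix G) (indicator S) v
nbrsIn-as-mulVec G v S = count-∧ (adj G v) S

adjMatrix-regular : ∀ {n} (G : Graph n) {k} → Regular G k → ∀ v → mulVec (adjMatrix G) (λ _ → 1ℚ) v ≡ ℕ→ℚ k
adjMatrix-regular G regular v = trans (sym (nbrsIn-as-mulVec G v (λ _ → true))) (cong ℕ→ℚ (regular v))

nbrsIn-≤-degree : ∀ {n} (G : Graph n) {k} → Regular G k → ∀ v S → nbrsIn G v S ≤ k
nbrsIn-≤-degree G regular v S = subst (nbrsIn G v S ≤_) (regular v) (count-mono (λ u → ∧-true (adj G v u)))
  where
  ∧-true : ∀ x {y} → x ∧ y ≡ true → x ∧ true ≡ true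
  ∧-true true  _ = refl
  ∧-true false ()

module Partition {n m} (part : Fin n → Fin m) where

  ι : Fin m → Fin n → ℚ
  ι t = indicator (cell part t)

  cellSize : Fin m → ℚ
  cellSize t = ℕ→ℚ (count (cell part t))

  cell-self : ∀ v → cell part (part v) v ≡ true
  cell-self v with part v Fin.≟ part v
  ... | yes _     = refl
  ... | no pv≢pv = ⊥-elim (pv≢pv refl)

  lift-expand : ∀ (g : Fin m → ℚ) v → g (part v) ≡ sumℚ (λ s → ι s v * g s)
  lift-expand g v = trans (sym (sumℚ-δˡ (part v) g)) (sumℚ-cong (λ s → cong (_* g s) (δ-cell s)))
    where
    δ-cell : ∀ s → δ (part v) s ≡ ι s v
    δ-cell s with part v Fin.≟ s
    ... | yes _ = refl
    ... | no _  = refl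

  ·-lift : ∀ (x : Fin n → ℚ) (g : Fin m → ℚ) →
           x · (g ∘ part) ≡ sumℚ (λ s → (x · ι s) * g s)
  ·-lift x g = begin
    x · (g ∘ part)                                 ≡⟨ ·-congʳ x (lift-expand g) ⟩
    sumℚ (λ v → x v * sumℚ (λ s → ι s v * g s))     ≡⟨ sumℚ-cong (λ v → sumℚ-*ˡ (x v) (λ s → ι s v * g s)) ⟨
    sumℚ (λ v → sumℚ (λ s → x v * (ι s v * g s)))   ≡⟨ sumℚ-comm (λ v s → x v * (ι s v * g s)) ⟩
    sumℚ (λ s → sumℚ (λ v → x v * (ι s v * g s)))   ≡⟨ sumℚ-cong (λ s → sumℚ-cong (λ v → ℚP.*-assoc (x v) (ι s v) (g s))) ⟨
    sumℚ (λ s → sumℚ (λ v → x v * ι s v * g s))     ≡⟨ sumℚ-cong (λ s → sumℚ-*ʳ (g s) (λ v → x v * ι s v)) ⟩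
    sumℚ (λ s → (x · ι s) * g s)                    ∎

  cellSum-lift : ∀ (g : Fin m → ℚ) s → ι s · (g ∘ part) ≡ cellSize s * g s
  cellSum-lift g s = begin
    ι s · (g ∘ part)              ≡⟨ sumℚ-cong on-cell ⟩
    sumℚ (λ v → ι s v * g s)      ≡⟨ sumℚ-*ʳ (g s) (ι s) ⟩
    sumℚ (ι s) * g s              ≡⟨ cong (_* g s) (count-as-sum (cell part s)) ⟨
    cellSize s * g s              ∎
    where
    on-cell : ∀ v → ι s v * g (part v) ≡ ι s v * g s
    on-cell v with part v Fin.≟ s
    ... | yes pv≡s = cong (λ t → 1ℚ * g t) pv≡s
    ... | no _     = trans (ℚP.*-zeroˡ (g (part v))) (sym (ℚP.*-zeroˡ (g s)))

  weighted-average : ∀ (X : Fin n → Bool) (z : Fin m → ℚ) → ℕ→ℚ (count X) ≢ 0ℚ →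
    ℕ→ℚ (count X) * sumℚ (λ l → (ℕ→ℚ (count (λ v → X v ∧ cell part l v)) // ℕ→ℚ (count X)) * z l)
      ≡ indicator X · (z ∘ part)
  weighted-average X z |X|≢0 = begin
    |X| * sumℚ (λ l → (q l // |X|) * z l)                      ≡⟨ sumℚ-*ˡ |X| (λ l → (q l // |X|) * z l) ⟨
    sumℚ (λ l → |X| * ((q l // |X|) * z l))                    ≡⟨ sumℚ-cong cancel ⟩
    sumℚ (λ l → q l * z l)                                     ≡⟨ sumℚ-cong (λ l → cong (_* z l) (count-∧ X (cell part l))) ⟩
    sumℚ (λ l → (indicator X · ι l) * z l)                     ≡⟨ ·-lift (indicator X) z ⟨
    indicator X · (z ∘ part)                                   ∎
    where
    |X| : ℚ
    |X| = ℕ→ℚ (count X)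
    q : Fin m → ℚ
    q l = ℕ→ℚ (count (λ v → X v ∧ cell part l v))
    cancel : ∀ l → |X| * ((q l // |X|) * z l) ≡ q l * z l
    cancel l = trans (solve 3 (λ p r z → p :* (r :* z) := (r :* p) :* z) refl |X| (q l // |X|) (z l))
                     (cong (_* z l) (//-cancelʳ (q l) |X|≢0))

module EquitablePartition {n m} (G : Graph n) (part : Fin n → Fin m) (B : Fin m → Fin m → ℕ)
                          (equitable : IsEquitablePartition G part B) where

  open Partition part public

  private
    Adj : Fin n → Fin n → ℚ
    Adj = adjMatrix G
    M : Fin m → Fin m → ℚ
    M = toℚMat B

  adjMatrix-cell : ∀ t v → mulVec Adj (ι t) v ≡ M (part v) t
  adjMatrix-cell t v = trans (sym (nbrsIn-as-mulVec G v (cell part t))) (cong ℕ→ℚ (proj₂ equitable v t))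

  mulVec-lift : ∀ (g : Fin m → ℚ) v → mulVec Adj (g ∘ part) v ≡ mulVec M g (part v)
  mulVec-lift g v = trans (·-lift (Adj v) g) (sumℚ-cong (λ s → cong (_* g s) (adjMatrix-cell s v)))

  lift-eigenvector : ∀ {g : Fin m → ℚ} {μ} → (∀ t → mulVec M g t ≡ μ * g t) →
                     ∀ v → mulVec Adj (g ∘ part) v ≡ μ * g (part v)
  lift-eigenvector {g} eigen v = trans (mulVec-lift g v) (eigen (part v))

  cellSize-≢0 : ∀ t → cellSize t ≢ 0ℚ
  cellSize-≢0 t with proj₁ equitable t
  ... | v , refl = count-≢0 (cell part (part v)) v (cell-self v)

  quotient-regular : ∀ {k} → Regular G k → ∀ t → mulVec M (λ _ → 1ℚ) t ≡ ℕ→ℚ k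
  quotient-regular regular t with proj₁ equitable t
  ... | v , refl = trans (sym (mulVec-lift (λ _ → 1ℚ) v)) (adjMatrix-regular G regular v)

  quotient-≤-degree : ∀ {k} → Regular G k → ∀ s t → B s t ≤ k
  quotient-≤-degree regular s t with proj₁ equitable s
  ... | v , refl = subst (_≤ _) (proj₂ equitable v t) (nbrsIn-≤-degree G regular v (cell part t))

  cellSize-quotient-sym : ∀ s t → cellSize s * M s t ≡ cellSize t * M t s
  cellSize-quotient-sym s t = begin
    cellSize s * M s t             ≡⟨ cellSum-lift (λ r → M r t) s ⟨
    ι s · (λ v → M (part v) t)     ≡⟨ ·-congʳ (ι s) (sym ∘ adjMatrix-cell t) ⟩
    ι s · mulVec Adj (ι t)         ≡⟨ ·-mulVec-sym Adj (adjMatrix-sym G) (ι s) (ι t) ⟩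
    mulVec Adj (ι s) · ι t         ≡⟨ ·-comm (mulVec Adj (ι s)) (ι t) ⟩
    ι t · mulVec Adj (ι s)         ≡⟨ ·-congʳ (ι t) (adjMatrix-cell s) ⟩
    ι t · (λ v → M (part v) s)     ≡⟨ cellSum-lift (λ r → M r s) t ⟩
    cellSize t * M t s             ∎

  average-eigenvector : ∀ {x : Fin n → ℚ} {y : Fin m → ℚ} {μ} → (∀ v → mulVec Adj x v ≡ μ * x v) →
                        (∀ t → cellSize t * y t ≡ x · ι t) → ∀ t → mulVec M y t ≡ μ * y t
  average-eigenvector {x} {y} {μ} eigen average t = *-cancelˡ-≢0 _ _ (cellSize-≢0 t) (begin
    cellSize t * mulVec M y t                  ≡⟨ sumℚ-*ˡ (cellSize t) (λ s → M t s * y s) ⟨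
    sumℚ (λ s → cellSize t * (M t s * y s))    ≡⟨ sumℚ-cong transpose ⟩
    sumℚ (λ s → (x · ι s) * M s t)             ≡⟨ ·-lift x (λ s → M s t) ⟨
    x · (λ v → M (part v) t)                   ≡⟨ ·-congʳ x (sym ∘ adjMatrix-cell t) ⟩
    x · mulVec Adj (ι t)                       ≡⟨ ·-mulVec-sym Adj (adjMatrix-sym G) x (ι t) ⟩
    mulVec Adj x · ι t                         ≡⟨ ·-comm (mulVec Adj x) (ι t) ⟩
    ι t · mulVec Adj x                         ≡⟨ ·-congʳ (ι t) eigen ⟩
    ι t · (λ v → μ * x v)                      ≡⟨ ·-scalarʳ (ι t) μ x ⟩
    μ * (ι t · x)                              ≡⟨ cong (μ *_) (trans (·-comm (ι t) x) (sym (average t))) ⟩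
    μ * (cellSize t * y t)                     ≡⟨ solve 3 (λ m c y → m :* (c :* y) := c :* (m :* y)) refl μ (cellSize t) (y t) ⟩
    cellSize t * (μ * y t)                     ∎)
    where
    transpose : ∀ s → cellSize t * (M t s * y s) ≡ (x · ι s) * M s t
    transpose s = begin
      cellSize t * (M t s * y s)   ≡⟨ ℚP.*-assoc (cellSize t) (M t s) (y s) ⟨
      cellSize t * M t s * y s     ≡⟨ cong (_* y s) (cellSize-quotient-sym s t) ⟨
      cellSize s * M s t * y s     ≡⟨ solve 3 (λ c m y → c :* m :* y := c :* y :* m) refl (cellSize s) (M s t) (y s) ⟩
      cellSize s * y s * M s t     ≡⟨ cong (_* M s t) (average s) ⟩
      (x · ι s) * M s t            ∎

module PerfectSet {n} (G : Graph n) (k : ℕ) (regular : Regular G k) (W : Fin n → Bool) (a b : ℕ)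
                  (a≤k : a ≤ k) (b≤k : b ≤ k) (perfect : IsPerfectSet G k W a b) where

  private
    Adj : Fin n → Fin n → ℚ
    Adj = adjMatrix G

  K A Bq : ℚ
  K  = ℕ→ℚ k
  A  = ℕ→ℚ a
  Bq = ℕ→ℚ b

  ω ω′ : Fin n → ℚ
  ω  = indicator W
  ω′ = indicator (λ v → not (W v))

  private
    in-W : ∀ v → W v ≡ true → nbrsIn G v W ≡ a × nbrsIn G v (λ u → not (W u)) ≡ k ℕ.∸ a
    in-W = proj₁ (proj₂ (proj₂ perfect))
    out-W : ∀ v → W v ≡ false → nbrsIn G v W ≡ b × nbrsIn G v (λ u → not (W u)) ≡ k ℕ.∸ b
    out-W = proj₂ (proj₂ (proj₂ perfect))
    x≡x*1+y*0 : ∀ x y → x ≡ x * 1ℚ + y * 0ℚ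
    x≡x*1+y*0 = solve 2 (λ x y → x := x :* con 1ℚ :+ y :* con 0ℚ) refl
    y≡x*0+y*1 : ∀ x y → y ≡ x * 0ℚ + y * 1ℚ
    y≡x*0+y*1 = solve 2 (λ x y → y := x :* con 0ℚ :+ y :* con 1ℚ) refl

  mulVec-ω : ∀ v → mulVec Adj ω v ≡ A * ω v + Bq * ω′ v
  mulVec-ω v with W v in Wv
  ... | true  = trans (sym (nbrsIn-as-mulVec G v W)) (trans (cong ℕ→ℚ (proj₁ (in-W v Wv))) (x≡x*1+y*0 A Bq))
  ... | false = trans (sym (nbrsIn-as-mulVec G v W)) (trans (cong ℕ→ℚ (proj₁ (out-W v Wv))) (y≡x*0+y*1 A Bq))

  mulVec-ω′ : ∀ v → mulVec Adj ω′ v ≡ (K - A) * ω v + (K - Bq) * ω′ v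
  mulVec-ω′ v with W v in Wv
  ... | true  = trans (sym (nbrsIn-as-mulVec G v (λ u → not (W u))))
                      (trans (cong ℕ→ℚ (proj₂ (in-W v Wv))) (trans (ℕ→ℚ-∸ a≤k) (x≡x*1+y*0 (K - A) (K - Bq))))
  ... | false = trans (sym (nbrsIn-as-mulVec G v (λ u → not (W u))))
                      (trans (cong ℕ→ℚ (proj₂ (out-W v Wv))) (trans (ℕ→ℚ-∸ b≤k) (y≡x*0+y*1 (K - A) (K - Bq))))

  eigenvector-balance : ∀ {U : Fin n → ℚ} {μ} → (∀ v → mulVec Adj U v ≡ μ * U v) →
    (μ * (ω · U) ≡ A * (ω · U) + Bq * (ω′ · U)) × (μ * (ω′ · U) ≡ (K - A) * (ω · U) + (K - Bq) * (ω′ · U))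
  eigenvector-balance {U} {μ} eigen = pairing ω A Bq mulVec-ω , pairing ω′ (K - A) (K - Bq) mulVec-ω′
    where
    pairing : ∀ χ α β → (∀ v → mulVec Adj χ v ≡ α * ω v + β * ω′ v) →
              μ * (χ · U) ≡ α * (ω · U) + β * (ω′ · U)
    pairing χ α β χ-nbrs = begin
      μ * (χ · U)                                  ≡⟨ ·-scalarʳ χ μ U ⟨
      χ · (λ v → μ * U v)                          ≡⟨ ·-congʳ χ (sym ∘ eigen) ⟩
      χ · mulVec Adj U                             ≡⟨ ·-mulVec-sym Adj (adjMatrix-sym G) χ U ⟩
      mulVec Adj χ · U                             ≡⟨ ·-comm (mulVec Adj χ) U ⟩
      U · mulVec Adj χ                             ≡⟨ ·-congʳ U χ-nbrs ⟩
      U · (λ v → α * ω v + β * ω′ v)               ≡⟨ ·-distribʳ-+ U (λ v → α * ω v) (λ v → β * ω′ v) ⟩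
      U · (λ v → α * ω v) + U · (λ v → β * ω′ v)   ≡⟨ cong₂ _+_ (·-scalarʳ U α ω) (·-scalarʳ U β ω′) ⟩
      α * (U · ω) + β * (U · ω′)                   ≡⟨ cong₂ (λ p q → α * p + β * q) (·-comm U ω) (·-comm U ω′) ⟩
      α * (ω · U) + β * (ω′ · U)                   ∎

  cut-double-count : K * ℕ→ℚ (count W) ≡ A * ℕ→ℚ (count W) + Bq * ℕ→ℚ (count (λ v → not (W v)))
  cut-double-count
    rewrite count-as-sum W | count-as-sum (λ v → not (W v)) | sym (·-one ω) | sym (·-one ω′)
    = proj₁ (eigenvector-balance {μ = K} (λ v → trans (adjMatrix-regular G regular v) (sym (ℚP.*-identityʳ K))))

  shifted-indicator-eigenvector : ∀ {β} → β * ((K - A) + Bq) ≡ Bq →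
                                  ∀ v → mulVec Adj (λ w → ω w - β) v ≡ (A - Bq) * (ω v - β)
  shifted-indicator-eigenvector {β} β*[K-A+B]≡B v = begin
    mulVec Adj (λ w → ω w - β) v                        ≡⟨ ·-distribʳ-- (Adj v) ω (λ _ → β) ⟩
    mulVec Adj ω v - Adj v · (λ _ → β)                  ≡⟨ cong₂ _-_ (mulVec-ω v) (·-const (Adj v) β) ⟩
    A * ω v + Bq * ω′ v - β * mulVec Adj (λ _ → 1ℚ) v   ≡⟨ cong₂ (λ p q → A * ω v + Bq * p - β * q)
                                                               (indicator-not W v) (adjMatrix-regular G regular v) ⟩
    A * ω v + Bq * (1ℚ - ω v) - β * K                   ≡⟨ regroup (ω v) ⟩
    (A - Bq) * (ω v - β) + (Bq - β * ((K - A) + Bq))    ≡⟨ cong (λ p → (A - Bq) * (ω v - β) + (Bq - p)) β*[K-A+B]≡B ⟩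
    (A - Bq) * (ω v - β) + (Bq - Bq)                    ≡⟨ solve 2 (λ p q → p :+ (q :- q) := p) refl _ Bq ⟩
    (A - Bq) * (ω v - β)                                ∎
    where
    regroup : ∀ x → A * x + Bq * (1ℚ - x) - β * K ≡ (A - Bq) * (x - β) + (Bq - β * ((K - A) + Bq))
    regroup = solve 5 (λ A B K β x → A :* x :+ B :* (con 1ℚ :- x) :- β :* K
                                    := (A :- B) :* (x :- β) :+ (B :- β :* ((K :- A) :+ B))) refl A Bq K β

z-y≢x⇒x+[y-z]≢0 : ∀ x y z → z - y ≢ x → x + (y - z) ≢ 0ℚ
z-y≢x⇒x+[y-z]≢0 x y z z-y≢x x+[y-z]≡0 = z-y≢x (begin
  z - y               ≡⟨ solve 3 (λ x y z → z :- y := x :- (x :+ (y :- z))) refl x y z ⟩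
  x - (x + (y - z))   ≡⟨ cong (λ p → x - p) x+[y-z]≡0 ⟩
  x - 0ℚ              ≡⟨ solve 1 (λ x → x :- con 0ℚ := x) refl x ⟩
  x                   ∎)

two-cell-system : ∀ {K A B c P Q X Y Π₁ Π₂ : ℚ} → P ≢ 0ℚ → Q ≢ 0ℚ → K * P ≡ A * P + B * Q →
  P * X ≡ Π₁ → Q * Y ≡ Π₂ → - c * Π₁ ≡ A * Π₁ + B * Π₂ → - c * Π₂ ≡ (K - A) * Π₁ + (K - B) * Π₂ →
  ((A + c) * X + (K - A) * Y ≡ 0ℚ) × (B * X + ((K - B) + c) * Y ≡ 0ℚ)
two-cell-system {K} {A} {B} {c} {P} {Q} {X} {Y} {Π₁} {Π₂} P≢0 Q≢0 sizes PX QY balance₁ balance₂ =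
  *-cancelˡ-≢0 _ 0ℚ P≢0 row₁ , *-cancelˡ-≢0 _ 0ℚ Q≢0 row₂
  where
  row₁ : P * ((A + c) * X + (K - A) * Y) ≡ P * 0ℚ
  row₁ = begin
    P * ((A + c) * X + (K - A) * Y)             ≡⟨ solve 6 (λ P A c X K Y → P :* ((A :+ c) :* X :+ (K :- A) :* Y)
                                                     := (A :+ c) :* (P :* X) :+ (K :* P :- A :* P) :* Y) refl P A c X K Y ⟩
    (A + c) * (P * X) + (K * P - A * P) * Y      ≡⟨ cong₂ (λ p q → (A + c) * p + (q - A * P) * Y) PX sizes ⟩
    (A + c) * Π₁ + (A * P + B * Q - A * P) * Y   ≡⟨ solve 7 (λ A c Π P B Q Y → (A :+ c) :* Π :+ (A :* P :+ B :* Q :- A :* P) :* Y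
                                                     := (A :+ c) :* Π :+ B :* (Q :* Y)) refl A c Π₁ P B Q Y ⟩
    (A + c) * Π₁ + B * (Q * Y)                   ≡⟨ cong (λ p → (A + c) * Π₁ + B * p) QY ⟩
    (A + c) * Π₁ + B * Π₂                        ≡⟨ solve 5 (λ A c Π B Π′ → (A :+ c) :* Π :+ B :* Π′
                                                     := A :* Π :+ B :* Π′ :- (:- c) :* Π) refl A c Π₁ B Π₂ ⟩
    A * Π₁ + B * Π₂ - - c * Π₁                   ≡⟨ cong (λ p → A * Π₁ + B * Π₂ - p) balance₁ ⟩
    A * Π₁ + B * Π₂ - (A * Π₁ + B * Π₂)          ≡⟨ solve 2 (λ x p → x :- x := p :* con 0ℚ) refl (A * Π₁ + B * Π₂) P ⟩
    P * 0ℚ                                       ∎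
  row₂ : Q * (B * X + ((K - B) + c) * Y) ≡ Q * 0ℚ
  row₂ = begin
    Q * (B * X + ((K - B) + c) * Y)                         ≡⟨ solve 8 (λ Q B X K c Y A P → Q :* (B :* X :+ ((K :- B) :+ c) :* Y)
                                                                 := (A :* P :+ B :* Q :- A :* P) :* X :+ ((K :- B) :+ c) :* (Q :* Y))
                                                                 refl Q B X K c Y A P ⟩
    (A * P + B * Q - A * P) * X + ((K - B) + c) * (Q * Y)   ≡⟨ cong (λ p → (p - A * P) * X + ((K - B) + c) * (Q * Y)) sizes ⟨
    (K * P - A * P) * X + ((K - B) + c) * (Q * Y)           ≡⟨ solve 7 (λ K P A X B c q → (K :* P :- A :* P) :* X :+ ((K :- B) :+ c) :* q
                                                                 := (K :- A) :* (P :* X) :+ ((K :- B) :+ c) :* q) refl K P A X B c (Q * Y) ⟩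
    (K - A) * (P * X) + ((K - B) + c) * (Q * Y)             ≡⟨ cong₂ (λ p q → (K - A) * p + ((K - B) + c) * q) PX QY ⟩
    (K - A) * Π₁ + ((K - B) + c) * Π₂                       ≡⟨ solve 6 (λ K A Π B c Π′ → (K :- A) :* Π :+ ((K :- B) :+ c) :* Π′
                                                                 := (K :- A) :* Π :+ (K :- B) :* Π′ :- (:- c) :* Π′) refl K A Π₁ B c Π₂ ⟩
    (K - A) * Π₁ + (K - B) * Π₂ - - c * Π₂                  ≡⟨ cong (λ p → (K - A) * Π₁ + (K - B) * Π₂ - p) balance₂ ⟩
    (K - A) * Π₁ + (K - B) * Π₂ - ((K - A) * Π₁ + (K - B) * Π₂)
                                                            ≡⟨ solve 2 (λ x q → x :- x := q :* con 0ℚ) refl ((K - A) * Π₁ + (K - B) * Π₂) Q ⟩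
    Q * 0ℚ                                                  ∎

two-by-two-nonsingular : ∀ {K A B c X Y : ℚ} → K + c ≢ 0ℚ → (A - B) + c ≢ 0ℚ →
  (A + c) * X + (K - A) * Y ≡ 0ℚ → B * X + ((K - B) + c) * Y ≡ 0ℚ → (X ≡ 0ℚ) × (Y ≡ 0ℚ)
two-by-two-nonsingular {K} {A} {B} {c} {X} {Y} K+c≢0 A-B+c≢0 row₁ row₂ = cancel-det X-eq , cancel-det Y-eq
  where
  cancel-det : ∀ {Z} → (K + c) * (((A - B) + c) * Z) ≡ (K + c) * (((A - B) + c) * 0ℚ) → Z ≡ 0ℚ
  cancel-det = *-cancelˡ-≢0 _ 0ℚ A-B+c≢0 ∘ *-cancelˡ-≢0 _ _ K+c≢0
  X-eq : (K + c) * (((A - B) + c) * X) ≡ (K + c) * (((A - B) + c) * 0ℚ)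
  X-eq = begin
    (K + c) * (((A - B) + c) * X)
      ≡⟨ solve 6 (λ K A B c X Y → (K :+ c) :* (((A :- B) :+ c) :* X)
           := ((K :- B) :+ c) :* ((A :+ c) :* X :+ (K :- A) :* Y) :- (K :- A) :* (B :* X :+ ((K :- B) :+ c) :* Y))
           refl K A B c X Y ⟩
    ((K - B) + c) * ((A + c) * X + (K - A) * Y) - (K - A) * (B * X + ((K - B) + c) * Y)
      ≡⟨ cong₂ (λ p q → ((K - B) + c) * p - (K - A) * q) row₁ row₂ ⟩
    ((K - B) + c) * 0ℚ - (K - A) * 0ℚ
      ≡⟨ solve 4 (λ K A B c → ((K :- B) :+ c) :* con 0ℚ :- (K :- A) :* con 0ℚ
           := (K :+ c) :* (((A :- B) :+ c) :* con 0ℚ)) refl K A B c ⟩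
    (K + c) * (((A - B) + c) * 0ℚ)
      ∎
  Y-eq : (K + c) * (((A - B) + c) * Y) ≡ (K + c) * (((A - B) + c) * 0ℚ)
  Y-eq = begin
    (K + c) * (((A - B) + c) * Y)
      ≡⟨ solve 6 (λ K A B c X Y → (K :+ c) :* (((A :- B) :+ c) :* Y)
           := (A :+ c) :* (B :* X :+ ((K :- B) :+ c) :* Y) :- B :* ((A :+ c) :* X :+ (K :- A) :* Y))
           refl K A B c X Y ⟩
    (A + c) * (B * X + ((K - B) + c) * Y) - B * ((A + c) * X + (K - A) * Y)
      ≡⟨ cong₂ (λ p q → (A + c) * p - B * q) row₂ row₁ ⟩
    (A + c) * 0ℚ - B * 0ℚ
      ≡⟨ solve 4 (λ K A B c → (A :+ c) :* con 0ℚ :- B :* con 0ℚ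
           := (K :+ c) :* (((A :- B) :+ c) :* con 0ℚ)) refl K A B c ⟩
    (K + c) * (((A - B) + c) * 0ℚ)
      ∎

module Corollary {n m} (G : Graph n) (k : ℕ) (part : Fin n → Fin m) (B : Fin m → Fin m → ℕ)
                 (W : Fin n → Bool) (a b : ℕ) (regular : Regular G k)
                 (equitable : IsEquitablePartition G part B) (perfect : IsPerfectSet G k W a b)
                 (a<k : a < k) (1≤b : 1 ≤ b) (b≤k : b ≤ k) where

  open EquitablePartition G part B equitable
  open PerfectSet G k regular W a b (ℕP.<⇒≤ a<k) b≤k perfect

  private
    M : Fin m → Fin m → ℚ
    M = toℚMat B
    |W|≢0 : ℕ→ℚ (count W) ≢ 0ℚ
    |W|≢0 = let (v , Wv) = proj₁ perfect in count-≢0 W v Wv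
    |W′|≢0 : ℕ→ℚ (count (λ v → not (W v))) ≢ 0ℚ
    |W′|≢0 = let (v , ¬Wv) = proj₁ (proj₂ perfect) in count-≢0 (λ v → not (W v)) v (cong not ¬Wv)

  ratio : Fin m → ℚ
  ratio t = ℕ→ℚ (count (λ v → cell part t v ∧ W v)) // ℕ→ℚ (count (cell part t))

  β : ℚ
  β = Bq // ((K - A) + Bq)

  h : Fin m → ℚ
  h t = ratio t - β

  β*[K-A+B]≡B : β * ((K - A) + Bq) ≡ Bq
  β*[K-A+B]≡B = //-cancelʳ Bq denominator≢0
    where
    denominator≢0 : (K - A) + Bq ≢ 0ℚ
    denominator≢0 K-A+B≡0 = ℕP.m<n⇒n≢0 1≤b (ℕP.m+n≡0⇒n≡0 (k ℕ.∸ a) (ℕ→ℚ≡0⇒≡0 (begin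
      ℕ→ℚ (k ℕ.∸ a ℕ.+ b)    ≡⟨ ℕ→ℚ-+ (k ℕ.∸ a) b ⟩
      ℕ→ℚ (k ℕ.∸ a) + Bq     ≡⟨ cong (_+ Bq) (ℕ→ℚ-∸ (ℕP.<⇒≤ a<k)) ⟩
      (K - A) + Bq           ≡⟨ K-A+B≡0 ⟩
      0ℚ                     ∎)))

  h-cell-average : ∀ t → cellSize t * h t ≡ (λ w → ω w - β) · ι t
  h-cell-average t = begin
    cellSize t * (ratio t - β)                          ≡⟨ solve 3 (λ n r β → n :* (r :- β) := r :* n :- β :* n) refl
                                                             (cellSize t) (ratio t) β ⟩
    ratio t * cellSize t - β * cellSize t               ≡⟨ cong₂ (λ p q → p - β * q) (//-cancelʳ _ (cellSize-≢0 t))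
                                                             (count-as-sum (cell part t)) ⟩
    ℕ→ℚ (count (λ v → cell part t v ∧ W v)) - β * sumℚ (ι t)
                                                        ≡⟨ cong₂ (λ p q → p - β * q) (count-∧ (cell part t) W) (sym (·-one (ι t))) ⟩
    ι t · ω - β * (ι t · (λ _ → 1ℚ))                    ≡⟨ cong (λ p → ι t · ω - p) (·-const (ι t) β) ⟨
    ι t · ω - ι t · (λ _ → β)                           ≡⟨ ·-distribʳ-- (ι t) ω (λ _ → β) ⟨
    ι t · (λ w → ω w - β)                               ≡⟨ ·-comm (ι t) (λ w → ω w - β) ⟩
    (λ w → ω w - β) · ι t                               ∎

  h-eigenvector : ∀ t → mulVec M h t ≡ (A - Bq) * h t
  h-eigenvector = average-eigenvector {x = λ w → ω w - β} {y = h} {μ = A - Bq}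
                    (shifted-indicator-eigenvector β*[K-A+B]≡B) h-cell-average

  shifted-ratio-solution : ∀ t → mulVec M h t + (Bq - A) * h t ≡ 0ℚ
  shifted-ratio-solution t = trans (cong (_+ (Bq - A) * h t) (h-eigenvector t))
    (solve 3 (λ A B x → (A :- B) :* x :+ (B :- A) :* x := con 0ℚ) refl A Bq (h t))

  nonconstant-ratio-eigenvalue : ∀ t → ratio t ≢ β →
    IsEigenvector M (A - Bq) h × IsEigenvalue (adjMatrix G) (A - Bq)
  nonconstant-ratio-eigenvalue t ratio≢β =
    ((t , h≢0) , h-eigenvector) ,
    (h ∘ part , (v , subst (λ s → h s ≢ 0ℚ) (sym pv≡t) h≢0) , lift-eigenvector {g = h} {μ = A - Bq} h-eigenvector)
    where
    h≢0 : h t ≢ 0ℚ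
    h≢0 = ratio≢β ∘ x∙y⁻¹≈ε⇒x≈y (ratio t) β
    v : Fin n
    v = proj₁ (proj₁ equitable t)
    pv≡t : part v ≡ t
    pv≡t = proj₂ (proj₁ equitable t)

  ratio-constant-or-eigenvalue :
    (∀ t → ratio t ≡ β) ⊎ (IsEigenvector M (A - Bq) h × IsEigenvalue (adjMatrix G) (A - Bq))
  ratio-constant-or-eigenvalue = decide (FinP.all? ratio≟β)
    where
    ratio≟β : ∀ t → Dec (ratio t ≡ β)
    ratio≟β t = ratio t ℚP.≟ β
    decide : Dec (∀ t → ratio t ≡ β) →
             (∀ t → ratio t ≡ β) ⊎ (IsEigenvector M (A - Bq) h × IsEigenvalue (adjMatrix G) (A - Bq))
    decide (yes constant)   = inj₁ constant
    decide (no nonconstant) =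
      inj₂ (uncurry nonconstant-ratio-eigenvalue (FinP.¬∀⟶∃¬ m (λ t → ratio t ≡ β) ratio≟β nonconstant))

  module CellPair (i j : Fin m) where

    bij bjj c e : ℚ
    bij = ℕ→ℚ (B i j)
    bjj = ℕ→ℚ (B j j)
    c   = bij - bjj
    e   = - (bij // (K + c))

    Sys : (Fin m → ℚ) → Set
    Sys x = ∀ l → mulVec M x l + c * x l ≡ (ℕ→ℚ (B l j) - bij) + δ l j * c

    -- Also holds when K + c = 0, where e is the junk value 0: then b_ij = 0 because b_jj ≤ k.
    e*[K+c]≡-bij : e * (K + c) ≡ - bij
    e*[K+c]≡-bij = by-cases ((K + c) ℚP.≟ 0ℚ)
      where
      by-cases : Dec (K + c ≡ 0ℚ) → e * (K + c) ≡ - bij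
      by-cases (no K+c≢0)  = trans (sym (ℚP.neg-distribˡ-* (bij // (K + c)) (K + c)))
                                   (cong -_ (//-cancelʳ bij K+c≢0))
      by-cases (yes K+c≡0) = begin
        e * (K + c)   ≡⟨ cong (e *_) K+c≡0 ⟩
        e * 0ℚ        ≡⟨ ℚP.*-zeroʳ e ⟩
        0ℚ            ≡⟨ cong (λ x → - ℕ→ℚ x) bij≡0 ⟨
        - bij         ∎
        where
        bij≡0 : B i j ≡ 0
        bij≡0 = ℕP.m+n≡0⇒n≡0 (k ℕ.∸ B j j) (ℕ→ℚ≡0⇒≡0 (begin
          ℕ→ℚ (k ℕ.∸ B j j ℕ.+ B i j)   ≡⟨ ℕ→ℚ-+ (k ℕ.∸ B j j) (B i j) ⟩
          ℕ→ℚ (k ℕ.∸ B j j) + bij       ≡⟨ cong (_+ bij) (ℕ→ℚ-∸ (quotient-≤-degree regular j j)) ⟩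
          (K - bjj) + bij               ≡⟨ solve 3 (λ K x y → (K :- y) :+ x := K :+ (x :- y)) refl K bij bjj ⟩
          K + c                         ≡⟨ K+c≡0 ⟩
          0ℚ                            ∎))

    particular-solution : Sys (λ l → δ l j + e)
    particular-solution l = begin
      mulVec M (λ s → δ s j + e) l + c * (δ l j + e)   ≡⟨ cong (_+ c * (δ l j + e)) row ⟩
      M l j + e * K + c * (δ l j + e)                  ≡⟨ solve 5 (λ m e K c δ → m :+ e :* K :+ c :* (δ :+ e)
                                                            := m :+ δ :* c :+ e :* (K :+ c)) refl (M l j) e K c (δ l j) ⟩
      M l j + δ l j * c + e * (K + c)                  ≡⟨ cong (M l j + δ l j * c +_) e*[K+c]≡-bij ⟩
      M l j + δ l j * c + - bij                        ≡⟨ solve 4 (λ m δ c b → m :+ δ :* c :+ :- b := m :- b :+ δ :* c)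
                                                            refl (M l j) (δ l j) c bij ⟩
      (M l j - bij) + δ l j * c                        ∎
      where
      row : mulVec M (λ s → δ s j + e) l ≡ M l j + e * K
      row = trans (·-distribʳ-+ (M l) (λ s → δ s j) (λ _ → e))
                  (cong₂ _+_ (mulVec-δ M j l) (trans (·-const (M l) e) (cong (e *_) (quotient-regular regular l))))

    deviation : (Fin m → ℚ) → Fin m → ℚ
    deviation d l = e - (d l - δ l j)

    deviation-eigenvector : ∀ {d} → Sys d → ∀ l → mulVec M (deviation d) l ≡ - c * deviation d l
    deviation-eigenvector {d} sys l = begin
      mulVec M (deviation d) l
        ≡⟨ ·-distribʳ-- (M l) (λ _ → e) (λ s → d s - δ s j) ⟩
      M l · (λ _ → e) - mulVec M (λ s → d s - δ s j) l
        ≡⟨ cong₂ _-_ (trans (·-const (M l) e) (cong (e *_) (quotient-regular regular l)))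
                     (trans (·-distribʳ-- (M l) d (λ s → δ s j)) (cong (λ p → mulVec M d l - p) (mulVec-δ M j l))) ⟩
      e * K - (mulVec M d l - M l j)
        ≡⟨ solve 8 (λ e K Md m c d δ b → e :* K :- (Md :- m)
             := (:- c) :* (e :- (d :- δ)) :+ (e :* (K :+ c) :+ b) :- ((Md :+ c :* d) :- ((m :- b) :+ δ :* c)))
             refl e K (mulVec M d l) (M l j) c (d l) (δ l j) bij ⟩
      - c * deviation d l + (e * (K + c) + bij) - ((mulVec M d l + c * d l) - ((M l j - bij) + δ l j * c))
        ≡⟨ cong₂ (λ p q → - c * deviation d l + (p + bij) - (q - ((M l j - bij) + δ l j * c)))
                 e*[K+c]≡-bij (sys l) ⟩
      - c * deviation d l + (- bij + bij) - (((M l j - bij) + δ l j * c) - ((M l j - bij) + δ l j * c))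
        ≡⟨ solve 3 (λ u b s → u :+ (:- b :+ b) :- (s :- s) := u)
             refl (- c * deviation d l) bij ((M l j - bij) + δ l j * c) ⟩
      - c * deviation d l
        ∎

    cellMean : (Fin n → Bool) → (Fin m → ℚ) → ℚ
    cellMean X d = sumℚ (λ l → (ℕ→ℚ (count (λ v → X v ∧ cell part l v)) // ℕ→ℚ (count X)) * (d l - δ l j))

    centred-cellMean : ∀ X d → ℕ→ℚ (count X) ≢ 0ℚ →
                       ℕ→ℚ (count X) * (e - cellMean X d) ≡ indicator X · (deviation d ∘ part)
    centred-cellMean X d |X|≢0 = begin
      |X| * (e - cellMean X d)                         ≡⟨ solve 3 (λ p e s → p :* (e :- s) := e :* p :- p :* s)
                                                            refl |X| e (cellMean X d) ⟩
      e * |X| - |X| * cellMean X d                     ≡⟨ cong₂ _-_ |X|e (weighted-average X (λ l → d l - δ l j) |X|≢0) ⟩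
      indicator X · (λ _ → e) - indicator X · (λ v → d (part v) - δ (part v) j)
                                                       ≡⟨ ·-distribʳ-- (indicator X) (λ _ → e) (λ v → d (part v) - δ (part v) j) ⟨
      indicator X · (deviation d ∘ part)               ∎
      where
      |X| : ℚ
      |X| = ℕ→ℚ (count X)
      |X|e : e * |X| ≡ indicator X · (λ _ → e)
      |X|e = sym (trans (·-const (indicator X) e)
                        (cong (e *_) (trans (·-one (indicator X)) (sym (count-as-sum X)))))

    quotient-system : ∀ d → Sys d →
      ((A + c) * (e - cellMean W d) + (K - A) * (e - cellMean (λ v → not (W v)) d) ≡ 0ℚ) ×
      (Bq * (e - cellMean W d) + ((K - Bq) + c) * (e - cellMean (λ v → not (W v)) d) ≡ 0ℚ)
    quotient-system d sys =
      uncurry (two-cell-system {K = K} {A} {Bq} {c} |W|≢0 |W′|≢0 cut-double-count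
                 (centred-cellMean W d |W|≢0) (centred-cellMean (λ v → not (W v)) d |W′|≢0))
              (eigenvector-balance {μ = - c} (lift-eigenvector {g = deviation d} {μ = - c} (deviation-eigenvector sys)))

    cellMeans-trivial : ∀ d → Sys d → bjj - bij ≢ K → bjj - bij ≢ A - Bq →
                        (cellMean W d ≡ e) × (cellMean (λ v → not (W v)) d ≡ e)
    cellMeans-trivial d sys bjj-bij≢K bjj-bij≢A-B =
      let row₁ , row₂ = quotient-system d sys
          X≡0 , Y≡0 = two-by-two-nonsingular {K = K} {A} {Bq} {c} (z-y≢x⇒x+[y-z]≢0 K bij bjj bjj-bij≢K)
                                              (z-y≢x⇒x+[y-z]≢0 (A - Bq) bij bjj bjj-bij≢A-B) row₁ row₂
      in sym (x∙y⁻¹≈ε⇒x≈y e (cellMean W d) X≡0) ,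
         sym (x∙y⁻¹≈ε⇒x≈y e (cellMean (λ v → not (W v)) d) Y≡0)

corollary2p6 :
  ∀ {n m : ℕ} (G : Graph n) (k : ℕ) (part : Fin n → Fin m) (B : Fin m → Fin m → ℕ)
    (W : Fin n → Bool) (a b : ℕ) →
  Connected G → Regular G k → 1 ≤ k →
  IsEquitablePartition G part B →
  IsPerfectSet G k W a b → a < k → 1 ≤ b → b ≤ k →
  let K  = ℕ→ℚ k
      A  = ℕ→ℚ a
      Bq = ℕ→ℚ b
      M  = toℚMat B
      W₂ = λ v → not (W v)
      ratio = λ (t : Fin m) → ℕ→ℚ (count (λ v → cell part t v ∧ W v)) // ℕ→ℚ (count (cell part t))
      h = λ (t : Fin m) → ratio t - Bq // ((K - A) + Bq)
  in
  -- (a)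
  ( (∀ (t : Fin m) → mulVec M h t + (Bq - A) * h t ≡ 0ℚ)
    × ( (∀ (t : Fin m) → ratio t ≡ Bq // ((K - A) + Bq))
        ⊎ (IsEigenvector M (A - Bq) h × IsEigenvalue (adjMatrix G) (A - Bq)) ) )
  ×
  -- (b)
  ( ∀ (i j : Fin m) → i ≢ j →
    let bij = ℕ→ℚ (B i j)
        bjj = ℕ→ℚ (B j j)
        c   = bij - bjj
        Sys = λ (x : Fin m → ℚ) → ∀ (l : Fin m) →
                mulVec M x l + c * x l ≡ (ℕ→ℚ (B l j) - bij) + δ l j * c
        e   = - (bij // (K + c))
        s₁  = λ (d : Fin m → ℚ) → sumℚ (λ l →
                (ℕ→ℚ (count (λ v → W v ∧ cell part l v)) // ℕ→ℚ (count W)) * (d l - δ l j))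
        s₂  = λ (d : Fin m → ℚ) → sumℚ (λ l →
                (ℕ→ℚ (count (λ v → W₂ v ∧ cell part l v)) // ℕ→ℚ (count W₂)) * (d l - δ l j))
    in
    -- (i)
    Σ (Fin m → ℚ) Sys
    -- (ii)
    × (∀ (d : Fin m → ℚ) → Sys d →
         ((A + c) * (e - s₁ d) + (K - A) * (e - s₂ d) ≡ 0ℚ)
         × (Bq * (e - s₁ d) + ((K - Bq) + c) * (e - s₂ d) ≡ 0ℚ))
    -- (iii)
    × (∀ (d : Fin m → ℚ) → Sys d → bjj - bij ≢ K → bjj - bij ≢ A - Bq →
         (s₁ d ≡ e) × (s₂ d ≡ e)) )
corollary2p6 G k part B W a b _ regular _ equitable perfect a<k 1≤b b≤k =
  (shifted-ratio-solution , ratio-constant-or-eigenvalue) ,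
  λ i j _ → let open CellPair i j in (_ , particular-solution) , quotient-system , cellMeans-trivial
  where open Corollary G k part B W a b regular equitable perfect a<k 1≤b b≤k
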